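{- For every positive integer $n$, $E_{\frac12\to a}(n) = \dfrac{3}{2}\left(5^{n-1} - 3^{n-1}\right)$.
   Context: Consider the Tower of Hanoi with $3$ pegs (numbered $1,2,3$) and $n$ disks $D_1,\dots,D_n$ of sizes $1,\dots,n$. A state is an assignment of each disk to a peg; on each peg the disks are stacked with sizes decreasing from bottom to top. A legal move takes the top disk of one peg and places it on top of another peg, provided that peg is empty or its top disk is larger than the moved disk. A random solution proceeds by repeatedly choosing the next move uniformly at random among all legal moves in the current state (independently of the past). $E_{\frac12\to a}(n)$ denotes the expected number of random moves needed, starting from the state in which the largest disk $D_n$ is on peg $2$ and all other disks $D_1,\dots,D_{n-1}$ are on peg $1$, until for the first time all $n$ disks are on a single peg (any peg; zero moves if this already holds initially). -}

module Defs where

open import Data.Bool using (Bool; true; false; _∧_; if_then_else_; not)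
open import Data.Nat as ℕ using (ℕ; zero; suc; _^_)
open import Data.Fin as Fin using (Fin; zero; suc; toℕ)
open import Data.Fin.Properties using () renaming (_≟_ to _≟ᶠ_)
open import Data.Maybe using (Maybe; just; nothing)
import Data.Maybe as Maybe
open import Data.Vec using (Vec; []; _∷_; _[_]≔_; replicate)
open import Data.List using (List; []; _∷_; _++_; concatMap; length; upTo; map)
open import Data.Product using (_×_; _,_)
open import Data.Integer using (+_)
open import Data.Rational using (ℚ; 0ℚ; 1ℚ; _+_; _*_; _-_; _/_)
open import Relation.Nullary.Decidable using (does)

Peg : Set
Peg = Fin 3

peg1 peg2 : Peg
peg1 = zero
peg2 = suc zero

-- A state of the n-disk puzzle: position i (0-based) holds the peg of disk
-- D_(i+1), i.e. the disk of size i+1.  Stacking order is determined by size.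
State : ℕ → Set
State n = Vec Peg n

topOf : ∀ {n} → State n → Peg → Maybe (Fin n)
topOf [] p = nothing
topOf (x ∷ xs) p = if does (x ≟ᶠ p) then just zero else Maybe.map suc (topOf xs p)

legalMove : ∀ {n} → State n → Peg → Peg → Maybe (Fin n)
legalMove s p q with does (p ≟ᶠ q) | topOf s p | topOf s q
... | true  | _      | _      = nothing
... | false | nothing | _     = nothing
... | false | just i | nothing = just i
... | false | just i | just j = if does (toℕ i ℕ.<? toℕ j) then just i else nothing

allPegs : List Peg
allPegs = zero ∷ suc zero ∷ suc (suc zero) ∷ []

successors : ∀ {n} → State n → List (State n)
successors s = concatMap (λ p → concatMap (λ q → succ p q) allPegs) allPegs
  where
  succ : Peg → Peg → List (State _)
  succ p q with legalMove s p q
  ... | nothing = []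
  ... | just i  = (s [ i ]≔ q) ∷ []

allSame : ∀ {n} → State n → Bool
allSame [] = true
allSame (x ∷ xs) = go xs
  where
  go : ∀ {m} → State m → Bool
  go [] = true
  go (y ∷ ys) = does (x ≟ᶠ y) ∧ go ys

-- A (sub-)probability distribution over states, as a weighted list
-- (repeated states allowed; their weights add up).
Dist : ℕ → Set
Dist n = List (State n × ℚ)

-- One step of the random walk stopped (killed) on reaching a solved state:
-- the mass on solved states is removed, every other state spreads its mass
-- uniformly over the states reached by its legal moves.
step : ∀ {n} → Dist n → Dist n
step [] = []
step ((s , w) ∷ d) with allSame s | successors s
... | true  | _       = step d
... | false | []      = step d
... | false | (t ∷ ts) = map (λ u → (u , w * (+ 1 / suc (length ts)))) (t ∷ ts) ++ step d

unsolvedMass : ∀ {n} → Dist n → ℚ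
unsolvedMass [] = 0ℚ
unsolvedMass ((s , w) ∷ d) = (if allSame s then 0ℚ else w) + unsolvedMass d

-- Initial state: D_n on peg 2, D_1..D_(n-1) on peg 1.
startState : (n : ℕ) → State (suc n)
startState zero = peg2 ∷ []
startState (suc n) = peg1 ∷ startState n

-- Distribution of the (stopped) walk after k moves, restricted to paths
-- that have not yet hit a solved state.
distAt : (n : ℕ) → ℕ → Dist (suc n)
distAt n zero = (startState n , 1ℚ) ∷ []
distAt n (suc k) = step (distAt n k)

-- P(T > k), where T is the number of moves until all disks lie on one peg
-- (for the puzzle with n+1 disks).
probGreater : ℕ → ℕ → ℚ
probGreater n k = unsolvedMass (distAt n k)

-- Partial sums  Σ_{k<t} P(T > k);  E[T] = Σ_{k≥0} P(T > k).
partialExp : ℕ → ℕ → ℚ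
partialExp n zero = 0ℚ
partialExp n (suc t) = partialExp n t + probGreater n t

fromℕℚ : ℕ → ℚ
fromℕℚ k = + k / 1

-- (3/2)(5^(m-1) - 3^(m-1)) for m = n+1 disks.
formula : ℕ → ℚ
formula n = (+ 3 / 2) * (fromℕℚ (5 ^ n) - fromℕℚ (3 ^ n))

module Submission where

-- Adding a largest disk below m + 1 smaller ones does not change the walk until the smaller
-- disks gather on one peg, because until then the largest disk cannot move.  This gives,
-- by recursion on the number of disks, the expected number of moves expectedTime from every
-- state, together with the weights gatherWeight of the pegs on which the disks first gather;
-- from a split tower (all but the largest disk on one peg) the expected time is
-- (3/2)(5^(m+1) - 3^(m+1)).  Checking the first-step equations at every unsolved state,
-- the potential Σ w · expectedTime of the walk after t moves drops by exactly P(T > t) in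
-- each move, so partialExp n t + potential = expectedTime (startState n) = formula n.
-- Finally expectedTime ≤ 5^(n+1) =: K bounds the potential by K times the mass it loses
-- per move, so the potential decays like K² / t.

open import Defs
open import Data.Nat using (ℕ; suc; _≥_)
open import Data.Product using (∃; Σ)
open import Data.Rational using (ℚ; 0ℚ; _<_; _-_; ∣_∣)

open import Agda.Builtin.FromNat using (Number; fromNat)
open import Data.Bool using (Bool; true; false; if_then_else_)
open import Data.Empty using (⊥-elim)
open import Data.Fin using (Fin; zero; suc; toℕ; inject₁; fromℕ)
open import Data.Fin.Properties using (toℕ-inject₁; toℕ-fromℕ; toℕ<n) renaming (_≟_ to _≟ᶠ_)
open import Data.Integer using (+_)
import Data.Integer as ℤ
import Data.Integer.Properties as ℤ
open import Data.List using (List; []; _∷_; _++_; map; length)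
open import Data.List.Properties using (map-++; length-map)
open import Data.List.Relation.Unary.All using (All; []; _∷_)
import Data.List.Relation.Unary.All as All
open import Data.List.Relation.Unary.All.Properties using (++⁺; map⁺)
open import Data.Maybe using (Maybe; just; nothing)
import Data.Maybe as Maybe
open import Data.Nat as ℕ using (zero)
import Data.Nat.Coprimality as Coprime
import Data.Nat.Literals as ℕ-Literals
import Data.Nat.Properties as ℕ
open import Data.Product using (_×_; _,_; proj₁; proj₂)
open import Data.Rational
  using (_+_; _*_; -_; _/_; 1ℚ; _≤_; nonNegative; positive; mkℚ)
import Data.Rational.Literals as ℚ-Literals
open import Data.Rational.Properties
  using ( +-*-commutativeRing; +-identityˡ; +-identityʳ; +-assoc; *-assoc; *-comm
        ; *-zeroˡ; *-zeroʳ; *-distribˡ-+; ≤-refl; ≤-reflexive; ≤-trans; <-irrefl; <-≤-trans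
        ; ≮⇒≥; _<?_; +-mono-≤; +-monoˡ-≤; +-monoʳ-≤; +-monoˡ-<; *-monoʳ-≤-nonNeg
        ; *-monoˡ-≤-nonNeg; nonNegative⁻¹; positive⁻¹; normalize-nonNeg; normalize-coprime
        ; toℚᵘ-injective; toℚᵘ-homo-+; toℚᵘ-homo-*; ∣-p∣≡∣p∣; 0≤p⇒∣p∣≡p; module ≤-Reasoning )
  renaming (_≟_ to _≟ℚ_)
import Data.Rational.Unnormalised as ℚᵘ
import Data.Rational.Unnormalised.Properties as ℚᵘ
open import Data.Unit using (⊤; tt)
open import Data.Vec using (Vec; []; _∷_; _[_]≔_; replicate; _∷ʳ_; init; last; initLast)
open import Data.Vec.Properties using (init-∷ʳ; last-∷ʳ)
open import Relation.Binary.PropositionalEquality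
open import Relation.Nullary using (yes; no)
open import Relation.Nullary.Decidable using (does; dec-true; dec-false)
import Tactic.RingSolver.Core.AlmostCommutativeRing as ACR
open import Tactic.RingSolver using (solve-∀)

instance
  ℕ-number : Number ℕ
  ℕ-number = ℕ-Literals.number
  ℚ-number : Number ℚ
  ℚ-number = ℚ-Literals.number
  unconstrained : ⊤
  unconstrained = tt

ℚ-ring : ACR.AlmostCommutativeRing _ _
ℚ-ring = ACR.fromCommutativeRing +-*-commutativeRing is-zero
  where
  is-zero : (x : ℚ) → Maybe (0ℚ ≡ x)
  is-zero x with 0ℚ ≟ℚ x
  ... | yes 0≡x = just 0≡x
  ... | no  _   = nothing

pattern P₁ = zero
pattern P₂ = suc zero
pattern P₃ = suc (suc zero)

-- Distinctness as a Boolean equation, so that it rewrites the tests in topOf and legalMove.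
_≠_ : Peg → Peg → Set
p ≠ q = does (p ≟ᶠ q) ≡ false

≟-refl : ∀ (p : Peg) → does (p ≟ᶠ p) ≡ true
≟-refl p = dec-true (p ≟ᶠ p) refl

otherPeg : Peg → Peg → Peg
otherPeg P₁ P₂ = P₃
otherPeg P₁ P₃ = P₂
otherPeg P₂ P₁ = P₃
otherPeg P₂ P₃ = P₁
otherPeg P₃ P₁ = P₂
otherPeg P₃ P₂ = P₁
otherPeg _  _  = P₁

otherPeg-unique : ∀ p q x → p ≠ q → x ≠ p → x ≠ q → x ≡ otherPeg p q
otherPeg-unique P₁ P₁ _  () _  _
otherPeg-unique P₂ P₂ _  () _  _
otherPeg-unique P₃ P₃ _  () _  _
otherPeg-unique P₁ P₂ P₁ _  () _
otherPeg-unique P₁ P₂ P₂ _  _  ()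
otherPeg-unique P₁ P₂ P₃ _  _  _  = refl
otherPeg-unique P₁ P₃ P₁ _  () _
otherPeg-unique P₁ P₃ P₂ _  _  _  = refl
otherPeg-unique P₁ P₃ P₃ _  _  ()
otherPeg-unique P₂ P₁ P₁ _  _  ()
otherPeg-unique P₂ P₁ P₂ _  () _
otherPeg-unique P₂ P₁ P₃ _  _  _  = refl
otherPeg-unique P₂ P₃ P₁ _  _  _  = refl
otherPeg-unique P₂ P₃ P₂ _  () _
otherPeg-unique P₂ P₃ P₃ _  _  ()
otherPeg-unique P₃ P₁ P₁ _  _  ()
otherPeg-unique P₃ P₁ P₂ _  _  _  = refl
otherPeg-unique P₃ P₁ P₃ _  () _
otherPeg-unique P₃ P₂ P₁ _  _  _  = refl
otherPeg-unique P₃ P₂ P₂ _  _  ()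
otherPeg-unique P₃ P₂ P₃ _  () _

≠-sym : ∀ p q → p ≠ q → q ≠ p
≠-sym p q p≠q with q ≟ᶠ p
... | no _     = refl
... | yes refl with () ← trans (sym (≟-refl q)) p≠q

otherPeg-≠ : ∀ p q → p ≠ q → p ≠ otherPeg p q × q ≠ otherPeg p q
otherPeg-≠ P₁ P₁ ()
otherPeg-≠ P₂ P₂ ()
otherPeg-≠ P₃ P₃ ()
otherPeg-≠ P₁ P₂ _ = refl , refl
otherPeg-≠ P₁ P₃ _ = refl , refl
otherPeg-≠ P₂ P₁ _ = refl , refl
otherPeg-≠ P₂ P₃ _ = refl , refl
otherPeg-≠ P₃ P₁ _ = refl , refl
otherPeg-≠ P₃ P₂ _ = refl , refl

moveTo : ∀ {n} → State n → Peg → Maybe (Fin n) → List (State n)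
moveTo s q nothing  = []
moveTo s q (just i) = (s [ i ]≔ q) ∷ []

overPegPairs : ∀ {A : Set} → (Peg → Peg → List A) → List A
overPegPairs f = (f P₁ P₂ ++ f P₁ P₃) ++ (f P₂ P₁ ++ f P₂ P₃) ++ (f P₃ P₁ ++ f P₃ P₂)

overPegPairs-cong : ∀ {A : Set} {f g : Peg → Peg → List A} →
  (∀ p q → f p q ≡ g p q) → overPegPairs f ≡ overPegPairs g
overPegPairs-cong f≡g = cong₂ _++_ (pair P₁ P₂ P₃) (cong₂ _++_ (pair P₂ P₁ P₃) (pair P₃ P₁ P₂))
  where pair = λ p q r → cong₂ _++_ (f≡g p q) (f≡g p r)

overPegPairs-map : ∀ {A B : Set} (h : A → B) (f : Peg → Peg → List A) →
  map h (overPegPairs f) ≡ overPegPairs (λ p q → map h (f p q))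
overPegPairs-map h f =
  trans (map-++ h (f P₁ P₂ ++ f P₁ P₃) _)
    (cong₂ _++_ (map-++ h (f P₁ P₂) _)
      (trans (map-++ h (f P₂ P₁ ++ f P₂ P₃) _)
        (cong₂ _++_ (map-++ h (f P₂ P₁) _) (map-++ h (f P₃ P₁) _))))

-- successors is defined through a local with-function, which unfolds only once
-- all six legality tests have been split.
successors≡overPegPairs : ∀ {n} (s : State n) →
  successors s ≡ overPegPairs (λ p q → moveTo s q (legalMove s p q))
successors≡overPegPairs s
  with legalMove s P₁ P₂ | legalMove s P₁ P₃ | legalMove s P₂ P₁
     | legalMove s P₂ P₃ | legalMove s P₃ P₁ | legalMove s P₃ P₂
... | nothing | nothing | nothing | nothing | nothing | nothing = refl
... | nothing | nothing | nothing | nothing | nothing | (just _) = refl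
... | nothing | nothing | nothing | nothing | (just _) | nothing = refl
... | nothing | nothing | nothing | nothing | (just _) | (just _) = refl
... | nothing | nothing | nothing | (just _) | nothing | nothing = refl
... | nothing | nothing | nothing | (just _) | nothing | (just _) = refl
... | nothing | nothing | nothing | (just _) | (just _) | nothing = refl
... | nothing | nothing | nothing | (just _) | (just _) | (just _) = refl
... | nothing | nothing | (just _) | nothing | nothing | nothing = refl
... | nothing | nothing | (just _) | nothing | nothing | (just _) = refl
... | nothing | nothing | (just _) | nothing | (just _) | nothing = refl
... | nothing | nothing | (just _) | nothing | (just _) | (just _) = refl
... | nothing | nothing | (just _) | (just _) | nothing | nothing = refl
... | nothing | nothing | (just _) | (just _) | nothing | (just _) = refl
... | nothing | nothing | (just _) | (just _) | (just _) | nothing = refl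
... | nothing | nothing | (just _) | (just _) | (just _) | (just _) = refl
... | nothing | (just _) | nothing | nothing | nothing | nothing = refl
... | nothing | (just _) | nothing | nothing | nothing | (just _) = refl
... | nothing | (just _) | nothing | nothing | (just _) | nothing = refl
... | nothing | (just _) | nothing | nothing | (just _) | (just _) = refl
... | nothing | (just _) | nothing | (just _) | nothing | nothing = refl
... | nothing | (just _) | nothing | (just _) | nothing | (just _) = refl
... | nothing | (just _) | nothing | (just _) | (just _) | nothing = refl
... | nothing | (just _) | nothing | (just _) | (just _) | (just _) = refl
... | nothing | (just _) | (just _) | nothing | nothing | nothing = refl
... | nothing | (just _) | (just _) | nothing | nothing | (just _) = refl
... | nothing | (just _) | (just _) | nothing | (just _) | nothing = refl
... | nothing | (just _) | (just _) | nothing | (just _) | (just _) = refl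
... | nothing | (just _) | (just _) | (just _) | nothing | nothing = refl
... | nothing | (just _) | (just _) | (just _) | nothing | (just _) = refl
... | nothing | (just _) | (just _) | (just _) | (just _) | nothing = refl
... | nothing | (just _) | (just _) | (just _) | (just _) | (just _) = refl
... | (just _) | nothing | nothing | nothing | nothing | nothing = refl
... | (just _) | nothing | nothing | nothing | nothing | (just _) = refl
... | (just _) | nothing | nothing | nothing | (just _) | nothing = refl
... | (just _) | nothing | nothing | nothing | (just _) | (just _) = refl
... | (just _) | nothing | nothing | (just _) | nothing | nothing = refl
... | (just _) | nothing | nothing | (just _) | nothing | (just _) = refl
... | (just _) | nothing | nothing | (just _) | (just _) | nothing = refl
... | (just _) | nothing | nothing | (just _) | (just _) | (just _) = refl
... | (just _) | nothing | (just _) | nothing | nothing | nothing = refl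
... | (just _) | nothing | (just _) | nothing | nothing | (just _) = refl
... | (just _) | nothing | (just _) | nothing | (just _) | nothing = refl
... | (just _) | nothing | (just _) | nothing | (just _) | (just _) = refl
... | (just _) | nothing | (just _) | (just _) | nothing | nothing = refl
... | (just _) | nothing | (just _) | (just _) | nothing | (just _) = refl
... | (just _) | nothing | (just _) | (just _) | (just _) | nothing = refl
... | (just _) | nothing | (just _) | (just _) | (just _) | (just _) = refl
... | (just _) | (just _) | nothing | nothing | nothing | nothing = refl
... | (just _) | (just _) | nothing | nothing | nothing | (just _) = refl
... | (just _) | (just _) | nothing | nothing | (just _) | nothing = refl
... | (just _) | (just _) | nothing | nothing | (just _) | (just _) = refl
... | (just _) | (just _) | nothing | (just _) | nothing | nothing = refl
... | (just _) | (just _) | nothing | (just _) | nothing | (just _) = refl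
... | (just _) | (just _) | nothing | (just _) | (just _) | nothing = refl
... | (just _) | (just _) | nothing | (just _) | (just _) | (just _) = refl
... | (just _) | (just _) | (just _) | nothing | nothing | nothing = refl
... | (just _) | (just _) | (just _) | nothing | nothing | (just _) = refl
... | (just _) | (just _) | (just _) | nothing | (just _) | nothing = refl
... | (just _) | (just _) | (just _) | nothing | (just _) | (just _) = refl
... | (just _) | (just _) | (just _) | (just _) | nothing | nothing = refl
... | (just _) | (just _) | (just _) | (just _) | nothing | (just _) = refl
... | (just _) | (just _) | (just _) | (just _) | (just _) | nothing = refl
... | (just _) | (just _) | (just _) | (just _) | (just _) | (just _) = refl

moveRule : ∀ {n} → Bool → Maybe (Fin n) → Maybe (Fin n) → Maybe (Fin n)
moveRule true  _        _        = nothing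
moveRule false nothing  _        = nothing
moveRule false (just i) nothing  = just i
moveRule false (just i) (just j) = if does (toℕ i ℕ.<? toℕ j) then just i else nothing

legalMove≡moveRule : ∀ {n} (s : State n) p q →
  legalMove s p q ≡ moveRule (does (p ≟ᶠ q)) (topOf s p) (topOf s q)
legalMove≡moveRule s p q with does (p ≟ᶠ q) | topOf s p | topOf s q
... | true  | _      | _      = refl
... | false | nothing | _     = refl
... | false | just _ | nothing = refl
... | false | just _ | just _  = refl

-- Adding a largest disk

topWithBottom : ∀ {n} → Maybe (Fin n) → Bool → Maybe (Fin (suc n))
topWithBottom (just i) _     = just (inject₁ i)
topWithBottom nothing  true  = just (fromℕ _)
topWithBottom nothing  false = nothing

topOf-∷ʳ : ∀ {n} (xs : State n) d p →
  topOf (xs ∷ʳ d) p ≡ topWithBottom (topOf xs p) (does (d ≟ᶠ p))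
topOf-∷ʳ [] d p with does (d ≟ᶠ p)
... | true  = refl
... | false = refl
topOf-∷ʳ (x ∷ xs) d p with does (x ≟ᶠ p)
... | true  = refl
... | false rewrite topOf-∷ʳ xs d p with topOf xs p | does (d ≟ᶠ p)
...   | just _  | _     = refl
...   | nothing | true  = refl
...   | nothing | false = refl

legalMove-∷ʳ : ∀ {n} (xs : State n) d p q →
  legalMove (xs ∷ʳ d) p q ≡
  moveRule (does (p ≟ᶠ q)) (topWithBottom (topOf xs p) (does (d ≟ᶠ p)))
                           (topWithBottom (topOf xs q) (does (d ≟ᶠ q)))
legalMove-∷ʳ xs d p q
  rewrite legalMove≡moveRule (xs ∷ʳ d) p q | topOf-∷ʳ xs d p | topOf-∷ʳ xs d q = refl

inject₁<?inject₁ : ∀ {n} (i j : Fin n) →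
  does (toℕ (inject₁ i) ℕ.<? toℕ (inject₁ j)) ≡ does (toℕ i ℕ.<? toℕ j)
inject₁<?inject₁ i j rewrite toℕ-inject₁ i | toℕ-inject₁ j = refl

inject₁<fromℕ : ∀ {n} (i : Fin n) → does (toℕ (inject₁ i) ℕ.<? toℕ (fromℕ n)) ≡ true
inject₁<fromℕ {n} i rewrite toℕ-inject₁ i | toℕ-fromℕ n = dec-true (toℕ i ℕ.<? n) (toℕ<n i)

fromℕ≮inject₁ : ∀ {n} (j : Fin n) → does (toℕ (fromℕ n) ℕ.<? toℕ (inject₁ j)) ≡ false
fromℕ≮inject₁ {n} j rewrite toℕ-inject₁ j | toℕ-fromℕ n =
  dec-false (n ℕ.<? toℕ j) (λ n<j → ℕ.<-asym n<j (toℕ<n j))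

∷ʳ-[inject₁]≔ : ∀ {A : Set} {n} (xs : Vec A n) i (q d : A) →
  (xs ∷ʳ d) [ inject₁ i ]≔ q ≡ (xs [ i ]≔ q) ∷ʳ d
∷ʳ-[inject₁]≔ (x ∷ xs) zero    q d = refl
∷ʳ-[inject₁]≔ (x ∷ xs) (suc i) q d = cong (x ∷_) (∷ʳ-[inject₁]≔ xs i q d)

∷ʳ-[fromℕ]≔ : ∀ {A : Set} {n} (xs : Vec A n) (q d : A) → (xs ∷ʳ d) [ fromℕ n ]≔ q ≡ xs ∷ʳ q
∷ʳ-[fromℕ]≔ []       q d = refl
∷ʳ-[fromℕ]≔ (x ∷ xs) q d = cong (x ∷_) (∷ʳ-[fromℕ]≔ xs q d)

topOf-∷-nothing : ∀ {n} x (ys : State n) p →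
  topOf (x ∷ ys) p ≡ nothing → x ≠ p × topOf ys p ≡ nothing
topOf-∷-nothing x ys p empty with does (x ≟ᶠ p) | topOf ys p
topOf-∷-nothing x ys p () | true  | _
topOf-∷-nothing x ys p _  | false | nothing = refl , refl
topOf-∷-nothing x ys p () | false | just _

allSame-avoiding : ∀ {n} {p q} x (ys : State n) → p ≠ q → x ≠ p → x ≠ q →
  topOf ys p ≡ nothing → topOf ys q ≡ nothing → allSame (x ∷ ys) ≡ true
allSame-avoiding x [] _ _ _ _ _ = refl
allSame-avoiding {p = p} {q} x (y ∷ zs) p≠q x≠p x≠q p-empty q-empty
  with topOf-∷-nothing y zs p p-empty | topOf-∷-nothing y zs q q-empty
... | y≠p , p-empty′ | y≠q , q-empty′
  rewrite trans (otherPeg-unique p q x p≠q x≠p x≠q) (sym (otherPeg-unique p q y p≠q y≠p y≠q))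
        | ≟-refl y
  = allSame-avoiding y zs p≠q y≠p y≠q p-empty′ q-empty′

twoEmptyPegs⇒solved : ∀ {n} (s : State (suc n)) p q → p ≠ q →
  topOf s p ≡ nothing → topOf s q ≡ nothing → allSame s ≡ true
twoEmptyPegs⇒solved (x ∷ ys) p q p≠q p-empty q-empty
  with topOf-∷-nothing x ys p p-empty | topOf-∷-nothing x ys q q-empty
... | x≠p , p-empty′ | x≠q , q-empty′ = allSame-avoiding x ys p≠q x≠p x≠q p-empty′ q-empty′

-- While the smaller disks are unsolved, the largest disk is blocked.
moveTo-∷ʳ : ∀ {n} (xs : State (suc n)) d p q → allSame xs ≡ false →
  moveTo (xs ∷ʳ d) q (legalMove (xs ∷ʳ d) p q) ≡ map (_∷ʳ d) (moveTo xs q (legalMove xs p q))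
moveTo-∷ʳ xs d p q unsolved rewrite legalMove-∷ʳ xs d p q | legalMove≡moveRule xs p q
  with does (p ≟ᶠ q) in p≠q | topOf xs p in p-top | topOf xs q in q-top
... | true  | _       | _       = refl
... | false | nothing | nothing
  with () ← trans (sym unsolved) (twoEmptyPegs⇒solved xs p q p≠q p-top q-top)
... | false | nothing | just j with does (d ≟ᶠ p)
...   | true  rewrite fromℕ≮inject₁ j = refl
...   | false = refl
moveTo-∷ʳ xs d p q unsolved | false | just i | nothing with does (d ≟ᶠ q)
... | true  rewrite inject₁<fromℕ i = cong (_∷ []) (∷ʳ-[inject₁]≔ xs i q d)
... | false = cong (_∷ []) (∷ʳ-[inject₁]≔ xs i q d)
moveTo-∷ʳ xs d p q unsolved | false | just i | just j
  rewrite inject₁<?inject₁ i j with does (toℕ i ℕ.<? toℕ j)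
... | true  = cong (_∷ []) (∷ʳ-[inject₁]≔ xs i q d)
... | false = refl

successors-∷ʳ : ∀ {n} (xs : State (suc n)) d → allSame xs ≡ false →
  successors (xs ∷ʳ d) ≡ map (_∷ʳ d) (successors xs)
successors-∷ʳ xs d unsolved = begin
  successors (xs ∷ʳ d)
    ≡⟨ successors≡overPegPairs (xs ∷ʳ d) ⟩
  overPegPairs (λ p q → moveTo (xs ∷ʳ d) q (legalMove (xs ∷ʳ d) p q))
    ≡⟨ overPegPairs-cong (λ p q → moveTo-∷ʳ xs d p q unsolved) ⟩
  overPegPairs (λ p q → map (_∷ʳ d) (moveTo xs q (legalMove xs p q)))
    ≡⟨ overPegPairs-map (_∷ʳ d) (λ p q → moveTo xs q (legalMove xs p q)) ⟨
  map (_∷ʳ d) (overPegPairs (λ p q → moveTo xs q (legalMove xs p q)))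
    ≡⟨ cong (map (_∷ʳ d)) (successors≡overPegPairs xs) ⟨
  map (_∷ʳ d) (successors xs) ∎
  where open ≡-Reasoning

replicate-∷ʳ : ∀ {A : Set} m (a : A) → replicate m a ∷ʳ a ≡ replicate (suc m) a
replicate-∷ʳ zero    a = refl
replicate-∷ʳ (suc m) a = cong (a ∷_) (replicate-∷ʳ m a)

allSame-replicate : ∀ m (a : Peg) → allSame (replicate (suc m) a) ≡ true
allSame-replicate zero    a = refl
allSame-replicate (suc m) a rewrite ≟-refl a = allSame-replicate m a

solved⇒replicate : ∀ {m} x (ys : State m) → allSame (x ∷ ys) ≡ true → ys ≡ replicate m x
solved⇒replicate x []       _ = refl
solved⇒replicate x (y ∷ ys) solved with x ≟ᶠ y
solved⇒replicate x (y ∷ ys) solved | yes refl = cong (x ∷_) (solved⇒replicate x ys solved)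
solved⇒replicate x (y ∷ ys) ()     | no _

topOfTower : ∀ {n} → Peg → Peg → Maybe (Fin (suc n))
topOfTower a p = if does (a ≟ᶠ p) then just zero else nothing

topOf-replicate-≠ : ∀ k {a p} → a ≠ p → topOf (replicate k a) p ≡ nothing
topOf-replicate-≠ zero    a≠p = refl
topOf-replicate-≠ (suc k) a≠p rewrite a≠p = cong (Maybe.map suc) (topOf-replicate-≠ k a≠p)

topOf-replicate : ∀ m (a p : Peg) → topOf (replicate (suc m) a) p ≡ topOfTower a p
topOf-replicate m a p with does (a ≟ᶠ p) in a≠p
... | true  = refl
... | false = cong (Maybe.map suc) (topOf-replicate-≠ m a≠p)

splitTower : ∀ m → Peg → Peg → State (suc (suc m))
splitTower m a d = replicate (suc m) a ∷ʳ d

splitTowerMove : ∀ m → Peg → Peg → Peg → Peg → Maybe (Fin (suc (suc m)))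
splitTowerMove m a d p q = moveRule (does (p ≟ᶠ q))
  (topWithBottom (topOfTower a p) (does (d ≟ᶠ p))) (topWithBottom (topOfTower a q) (does (d ≟ᶠ q)))

legalMove-splitTower : ∀ m a d p q → legalMove (splitTower m a d) p q ≡ splitTowerMove m a d p q
legalMove-splitTower m a d p q rewrite legalMove-∷ʳ (replicate (suc m) a) d p q
  | topOf-replicate m a p | topOf-replicate m a q = refl

successors-splitTower : ∀ m a d → successors (splitTower m a d) ≡
  overPegPairs (λ p q → moveTo (splitTower m a d) q (splitTowerMove m a d p q))
successors-splitTower m a d = trans (successors≡overPegPairs (splitTower m a d))
  (overPegPairs-cong λ p q → cong (moveTo (splitTower m a d) q) (legalMove-splitTower m a d p q))

sumOver : ∀ {A : Set} → (A → ℚ) → List A → ℚ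
sumOver f []       = 0ℚ
sumOver f (x ∷ xs) = f x + sumOver f xs

sumOver-xyz : ∀ {A : Set} (f : A → ℚ) x y z → sumOver f (x ∷ y ∷ z ∷ []) ≡ f x + f y + f z
sumOver-xyz f x y z = reorder (f x) (f y) (f z)
  where
  reorder : ∀ x y z → x + (y + (z + 0ℚ)) ≡ x + y + z
  reorder = solve-∀ ℚ-ring

sumOver-yxz : ∀ {A : Set} (f : A → ℚ) x y z → sumOver f (y ∷ x ∷ z ∷ []) ≡ f x + f y + f z
sumOver-yxz f x y z = reorder (f x) (f y) (f z)
  where
  reorder : ∀ x y z → y + (x + (z + 0ℚ)) ≡ x + y + z
  reorder = solve-∀ ℚ-ring

sumOver-zxy : ∀ {A : Set} (f : A → ℚ) x y z → sumOver f (z ∷ x ∷ y ∷ []) ≡ f x + f y + f z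
sumOver-zxy f x y z = reorder (f x) (f y) (f z)
  where
  reorder : ∀ x y z → z + (x + (y + 0ℚ)) ≡ x + y + z
  reorder = solve-∀ ℚ-ring

sumOver-zyx : ∀ {A : Set} (f : A → ℚ) x y z → sumOver f (z ∷ y ∷ x ∷ []) ≡ f x + f y + f z
sumOver-zyx f x y z = reorder (f x) (f y) (f z)
  where
  reorder : ∀ x y z → z + (y + (x + 0ℚ)) ≡ x + y + z
  reorder = solve-∀ ℚ-ring

splitTower-moves : ∀ m a d → a ≠ d →
  let T = splitTower m a d; b = otherPeg a d; tail = replicate m a ∷ʳ d in
  length (successors T) ≡ 3 ×
  (∀ f → sumOver f (successors T) ≡ f (d ∷ tail) + f (b ∷ tail) + f (T [ fromℕ (suc m) ]≔ b))
splitTower-moves m P₁ P₁ ()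
splitTower-moves m P₂ P₂ ()
splitTower-moves m P₃ P₃ ()
splitTower-moves m P₁ P₂ _ rewrite successors-splitTower m P₁ P₂ = refl , λ f → sumOver-xyz f _ _ _
splitTower-moves m P₁ P₃ _ rewrite successors-splitTower m P₁ P₃ = refl , λ f → sumOver-yxz f _ _ _
splitTower-moves m P₂ P₁ _ rewrite successors-splitTower m P₂ P₁ = refl , λ f → sumOver-zxy f _ _ _
splitTower-moves m P₂ P₃ _ rewrite successors-splitTower m P₂ P₃ = refl , λ f → sumOver-yxz f _ _ _
splitTower-moves m P₃ P₁ _ rewrite successors-splitTower m P₃ P₁ = refl , λ f → sumOver-zxy f _ _ _
splitTower-moves m P₃ P₂ _ rewrite successors-splitTower m P₃ P₂ = refl , λ f → sumOver-zyx f _ _ _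

infixr 8 _^_
_^_ : ℚ → ℕ → ℚ
x ^ zero  = 1ℚ
x ^ suc n = x * x ^ n

totalWeight : ℕ → ℚ
totalWeight m = 5 ^ suc m - 3 ^ suc m

gatherStep : ℕ → (Peg → ℚ) → Peg → Peg → ℚ
gatherStep m w d c =
  if does (c ≟ᶠ d) then 2 * 5 ^ suc m + 3 * w d else w c + 2 * w (otherPeg c d)

-- gatherWeight m s c / totalWeight m is the probability that the walk from s first gathers
-- its m + 1 disks on peg c.  With a largest disk added on d, the smaller disks first gather
-- on their own; if they gather away from d, the walk continues from a split tower, whose
-- gathering weights and expected time (3/2) totalWeight m enter gatherStep and expectedTime.
gatherWeight : (m : ℕ) → State (suc m) → Peg → ℚ
gatherWeight zero    (a ∷ []) c = if does (a ≟ᶠ c) then 2 else 0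
gatherWeight (suc m) s        c = gatherStep m (gatherWeight m (init s)) (last s) c

expectedTime : (m : ℕ) → State (suc m) → ℚ
expectedTime zero    s = 0
expectedTime (suc m) s =
  expectedTime m (init s) + (+ 3 / 2) * (totalWeight m - gatherWeight m (init s) (last s))

gatherWeight-∷ʳ : ∀ m (xs : State (suc m)) d c →
  gatherWeight (suc m) (xs ∷ʳ d) c ≡ gatherStep m (gatherWeight m xs) d c
gatherWeight-∷ʳ m xs d c rewrite init-∷ʳ d xs | last-∷ʳ d xs = refl

expectedTime-∷ʳ : ∀ m (xs : State (suc m)) d → expectedTime (suc m) (xs ∷ʳ d) ≡
  expectedTime m xs + (+ 3 / 2) * (totalWeight m - gatherWeight m xs d)
expectedTime-∷ʳ m xs d rewrite init-∷ʳ d xs | last-∷ʳ d xs = refl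

totalWeight-suc : ∀ m → 2 * 5 ^ suc m + 3 * totalWeight m ≡ totalWeight (suc m)
totalWeight-suc m = identity (5 ^ m) (3 ^ m)
  where
  identity : ∀ x y → 2 * (5 * x) + 3 * (5 * x - 3 * y) ≡ 5 * (5 * x) - 3 * (3 * y)
  identity = solve-∀ ℚ-ring

gatherStep-cong : ∀ m {v w} d c → (∀ e → v e ≡ w e) → gatherStep m v d c ≡ gatherStep m w d c
gatherStep-cong m d c v≗w with does (c ≟ᶠ d)
... | true  = cong (λ x → 2 * 5 ^ suc m + 3 * x) (v≗w d)
... | false = cong₂ (λ x y → x + 2 * y) (v≗w c) (v≗w (otherPeg c d))

gatherWeight-∷ʳ′ : ∀ m (xs : State (suc m)) d c {w} → (∀ e → gatherWeight m xs e ≡ w e) →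
  gatherWeight (suc m) (xs ∷ʳ d) c ≡ gatherStep m w d c
gatherWeight-∷ʳ′ m xs d c xs≗w = trans (gatherWeight-∷ʳ m xs d c) (gatherStep-cong m d c xs≗w)

expectedTime-∷ʳ′ : ∀ m (xs : State (suc m)) d {t g} →
  expectedTime m xs ≡ t → gatherWeight m xs d ≡ g →
  expectedTime (suc m) (xs ∷ʳ d) ≡ t + (+ 3 / 2) * (totalWeight m - g)
expectedTime-∷ʳ′ m xs d refl refl = expectedTime-∷ʳ m xs d

-- Closed forms on towers, and on near-towers x ∷ replicate m a (the top disk moved off)

towerWeight : ℕ → Peg → Peg → ℚ
towerWeight m a c = if does (a ≟ᶠ c) then totalWeight m else 0

nearTowerWeight : ℕ → Peg → Peg → Peg → ℚ
nearTowerWeight m a x c =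
  if does (c ≟ᶠ a) then 5 * 5 ^ m - 5 * 3 ^ m
  else if does (c ≟ᶠ x) then 3 ^ m + (- 1) ^ m
  else 3 ^ m - (- 1) ^ m

towerWeight-diag : ∀ m a → towerWeight m a a ≡ totalWeight m
towerWeight-diag m a rewrite ≟-refl a = refl

nearTowerWeight-tower : ∀ m a x → nearTowerWeight m a x a ≡ 5 * 5 ^ m - 5 * 3 ^ m
nearTowerWeight-tower m a x rewrite ≟-refl a = refl

towerWeight-≠ : ∀ m a c → a ≠ c → towerWeight m a c ≡ 0
towerWeight-≠ m a c a≠c rewrite a≠c = refl

nearTowerWeight-near : ∀ m a x → x ≠ a → nearTowerWeight m a x x ≡ 3 ^ m + (- 1) ^ m
nearTowerWeight-near m a x x≠a rewrite x≠a | ≟-refl x = refl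

nearTowerWeight-far : ∀ m a x c → c ≠ a → c ≠ x → nearTowerWeight m a x c ≡ 3 ^ m - (- 1) ^ m
nearTowerWeight-far m a x c c≠a c≠x rewrite c≠a | c≠x = refl

towerWeight-step : ∀ m a c → gatherStep m (towerWeight m a) a c ≡ towerWeight (suc m) a c
towerWeight-step m P₁ P₁ = totalWeight-suc m
towerWeight-step m P₁ P₂ = refl
towerWeight-step m P₁ P₃ = refl
towerWeight-step m P₂ P₁ = refl
towerWeight-step m P₂ P₂ = totalWeight-suc m
towerWeight-step m P₂ P₃ = refl
towerWeight-step m P₃ P₁ = refl
towerWeight-step m P₃ P₂ = refl
towerWeight-step m P₃ P₃ = totalWeight-suc m

gatherWeight-replicate : ∀ m a c → gatherWeight m (replicate (suc m) a) c ≡ towerWeight m a c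
gatherWeight-replicate zero    a c = refl
gatherWeight-replicate (suc m) a c = begin
  gatherWeight (suc m) (replicate (suc (suc m)) a) c
    ≡⟨ cong (λ s → gatherWeight (suc m) s c) (replicate-∷ʳ (suc m) a) ⟨
  gatherWeight (suc m) (replicate (suc m) a ∷ʳ a) c
    ≡⟨ gatherWeight-∷ʳ′ m _ a c (gatherWeight-replicate m a) ⟩
  gatherStep m (towerWeight m a) a c
    ≡⟨ towerWeight-step m a c ⟩
  towerWeight (suc m) a c ∎
  where open ≡-Reasoning

expectedTime-replicate : ∀ m a → expectedTime m (replicate (suc m) a) ≡ 0
expectedTime-replicate zero    a = refl
expectedTime-replicate (suc m) a = begin
  expectedTime (suc m) (replicate (suc (suc m)) a)
    ≡⟨ cong (expectedTime (suc m)) (replicate-∷ʳ (suc m) a) ⟨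
  expectedTime (suc m) (replicate (suc m) a ∷ʳ a)
    ≡⟨ expectedTime-∷ʳ′ m _ a (expectedTime-replicate m a)
         (trans (gatherWeight-replicate m a a) (towerWeight-diag m a)) ⟩
  0 + (+ 3 / 2) * (totalWeight m - totalWeight m)
    ≡⟨ identity (totalWeight m) ⟩
  0 ∎
  where
  open ≡-Reasoning
  identity : ∀ x → 0 + (+ 3 / 2) * (x - x) ≡ 0
  identity = solve-∀ ℚ-ring

nearTowerWeight-base : ∀ a x c → a ≠ x → gatherWeight 0 (x ∷ []) c ≡ nearTowerWeight 0 a x c
nearTowerWeight-base P₁ P₁ _  ()
nearTowerWeight-base P₂ P₂ _  ()
nearTowerWeight-base P₃ P₃ _  ()
nearTowerWeight-base P₁ P₂ P₁ _ = refl
nearTowerWeight-base P₁ P₂ P₂ _ = refl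
nearTowerWeight-base P₁ P₂ P₃ _ = refl
nearTowerWeight-base P₁ P₃ P₁ _ = refl
nearTowerWeight-base P₁ P₃ P₂ _ = refl
nearTowerWeight-base P₁ P₃ P₃ _ = refl
nearTowerWeight-base P₂ P₁ P₁ _ = refl
nearTowerWeight-base P₂ P₁ P₂ _ = refl
nearTowerWeight-base P₂ P₁ P₃ _ = refl
nearTowerWeight-base P₂ P₃ P₁ _ = refl
nearTowerWeight-base P₂ P₃ P₂ _ = refl
nearTowerWeight-base P₂ P₃ P₃ _ = refl
nearTowerWeight-base P₃ P₁ P₁ _ = refl
nearTowerWeight-base P₃ P₁ P₂ _ = refl
nearTowerWeight-base P₃ P₁ P₃ _ = refl
nearTowerWeight-base P₃ P₂ P₁ _ = refl
nearTowerWeight-base P₃ P₂ P₂ _ = refl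
nearTowerWeight-base P₃ P₂ P₃ _ = refl

nearTowerWeight-step : ∀ m a x c → a ≠ x →
  gatherStep m (nearTowerWeight m a x) a c ≡ nearTowerWeight (suc m) a x c
nearTowerWeight-step m = cases
  where
  at-a : ∀ x y → 2 * (5 * x) + 3 * (5 * x - 5 * y) ≡ 5 * (5 * x) - 5 * (3 * y)
  at-a = solve-∀ ℚ-ring
  at-x : ∀ y s → (y + s) + 2 * (y - s) ≡ 3 * y + (- 1) * s
  at-x = solve-∀ ℚ-ring
  at-other : ∀ y s → (y - s) + 2 * (y + s) ≡ 3 * y - (- 1) * s
  at-other = solve-∀ ℚ-ring
  x = 5 ^ m
  y = 3 ^ m
  s = (- 1) ^ m
  cases : ∀ a x c → a ≠ x → gatherStep m (nearTowerWeight m a x) a c ≡ nearTowerWeight (suc m) a x c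
  cases P₁ P₁ _  ()
  cases P₂ P₂ _  ()
  cases P₃ P₃ _  ()
  cases P₁ P₂ P₁ _ = at-a x y
  cases P₁ P₂ P₂ _ = at-x y s
  cases P₁ P₂ P₃ _ = at-other y s
  cases P₁ P₃ P₁ _ = at-a x y
  cases P₁ P₃ P₂ _ = at-other y s
  cases P₁ P₃ P₃ _ = at-x y s
  cases P₂ P₁ P₁ _ = at-x y s
  cases P₂ P₁ P₂ _ = at-a x y
  cases P₂ P₁ P₃ _ = at-other y s
  cases P₂ P₃ P₁ _ = at-other y s
  cases P₂ P₃ P₂ _ = at-a x y
  cases P₂ P₃ P₃ _ = at-x y s
  cases P₃ P₁ P₁ _ = at-x y s
  cases P₃ P₁ P₂ _ = at-other y s
  cases P₃ P₁ P₃ _ = at-a x y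
  cases P₃ P₂ P₁ _ = at-other y s
  cases P₃ P₂ P₂ _ = at-x y s
  cases P₃ P₂ P₃ _ = at-a x y

gatherWeight-nearTower : ∀ m a x c → a ≠ x →
  gatherWeight m (x ∷ replicate m a) c ≡ nearTowerWeight m a x c
gatherWeight-nearTower zero    a x c a≠x = nearTowerWeight-base a x c a≠x
gatherWeight-nearTower (suc m) a x c a≠x = begin
  gatherWeight (suc m) (x ∷ replicate (suc m) a) c
    ≡⟨ cong (λ s → gatherWeight (suc m) (x ∷ s) c) (replicate-∷ʳ m a) ⟨
  gatherWeight (suc m) ((x ∷ replicate m a) ∷ʳ a) c
    ≡⟨ gatherWeight-∷ʳ′ m _ a c (λ e → gatherWeight-nearTower m a x e a≠x) ⟩
  gatherStep m (nearTowerWeight m a x) a c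
    ≡⟨ nearTowerWeight-step m a x c a≠x ⟩
  nearTowerWeight (suc m) a x c ∎
  where open ≡-Reasoning

expectedTime-nearTower : ∀ m a x → a ≠ x →
  expectedTime m (x ∷ replicate m a) ≡ (+ 3 / 2) * (3 ^ m - 1)
expectedTime-nearTower zero    a x a≠x = refl
expectedTime-nearTower (suc m) a x a≠x = begin
  expectedTime (suc m) (x ∷ replicate (suc m) a)
    ≡⟨ cong (λ s → expectedTime (suc m) (x ∷ s)) (replicate-∷ʳ m a) ⟨
  expectedTime (suc m) ((x ∷ replicate m a) ∷ʳ a)
    ≡⟨ expectedTime-∷ʳ′ m _ a (expectedTime-nearTower m a x a≠x)
         (trans (gatherWeight-nearTower m a x a a≠x) (nearTowerWeight-tower m a x)) ⟩
  (+ 3 / 2) * (3 ^ m - 1) + (+ 3 / 2) * (totalWeight m - (5 * 5 ^ m - 5 * 3 ^ m))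
    ≡⟨ identity (5 ^ m) (3 ^ m) ⟩
  (+ 3 / 2) * (3 ^ suc m - 1) ∎
  where
  open ≡-Reasoning
  identity : ∀ x y → (+ 3 / 2) * (y - 1) + (+ 3 / 2) * ((5 * x - 3 * y) - (5 * x - 5 * y))
                   ≡ (+ 3 / 2) * (3 * y - 1)
  identity = solve-∀ ℚ-ring

gatherWeight-splitTower : ∀ m a d c →
  gatherWeight (suc m) (splitTower m a d) c ≡ gatherStep m (towerWeight m a) d c
gatherWeight-splitTower m a d c = gatherWeight-∷ʳ′ m _ d c (gatherWeight-replicate m a)

expectedTime-splitTower : ∀ m a d → a ≠ d →
  expectedTime (suc m) (splitTower m a d) ≡ (+ 3 / 2) * totalWeight m
expectedTime-splitTower m a d a≠d = trans
  (expectedTime-∷ʳ′ m _ d (expectedTime-replicate m a)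
    (trans (gatherWeight-replicate m a d) (towerWeight-≠ m a d a≠d)))
  (identity (totalWeight m))
  where
  identity : ∀ T → 0 + (+ 3 / 2) * (T - 0) ≡ (+ 3 / 2) * T
  identity = solve-∀ ℚ-ring

splitTower-gatherStep-mean : ∀ m a d c → a ≠ d → let b = otherPeg a d in
  gatherStep m (nearTowerWeight m a d) d c + gatherStep m (nearTowerWeight m a b) d c
    + gatherStep m (towerWeight m a) b c ≡ 3 * gatherStep m (towerWeight m a) d c
splitTower-gatherStep-mean m = cases
  where
  at-d : ∀ x y s → (2 * (5 * x) + 3 * (y + s)) + (2 * (5 * x) + 3 * (y - s))
                     + (0 + 2 * (5 * x - 3 * y)) ≡ 3 * (2 * (5 * x) + 3 * 0)
  at-d = solve-∀ ℚ-ring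
  at-a : ∀ x y s → ((5 * x - 5 * y) + 2 * (y - s)) + ((5 * x - 5 * y) + 2 * (y + s))
                     + ((5 * x - 3 * y) + 2 * 0) ≡ 3 * ((5 * x - 3 * y) + 2 * 0)
  at-a = solve-∀ ℚ-ring
  at-b : ∀ x y s → ((y - s) + 2 * (5 * x - 5 * y)) + ((y + s) + 2 * (5 * x - 5 * y))
                     + (2 * (5 * x) + 3 * 0) ≡ 3 * (0 + 2 * (5 * x - 3 * y))
  at-b = solve-∀ ℚ-ring
  x = 5 ^ m
  y = 3 ^ m
  s = (- 1) ^ m
  cases : ∀ a d c → a ≠ d → let b = otherPeg a d in
    gatherStep m (nearTowerWeight m a d) d c + gatherStep m (nearTowerWeight m a b) d c
      + gatherStep m (towerWeight m a) b c ≡ 3 * gatherStep m (towerWeight m a) d c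
  cases P₁ P₁ _  ()
  cases P₂ P₂ _  ()
  cases P₃ P₃ _  ()
  cases P₁ P₂ P₁ _ = at-a x y s
  cases P₁ P₂ P₂ _ = at-d x y s
  cases P₁ P₂ P₃ _ = at-b x y s
  cases P₁ P₃ P₁ _ = at-a x y s
  cases P₁ P₃ P₂ _ = at-b x y s
  cases P₁ P₃ P₃ _ = at-d x y s
  cases P₂ P₁ P₁ _ = at-d x y s
  cases P₂ P₁ P₂ _ = at-a x y s
  cases P₂ P₁ P₃ _ = at-b x y s
  cases P₂ P₃ P₁ _ = at-b x y s
  cases P₂ P₃ P₂ _ = at-a x y s
  cases P₂ P₃ P₃ _ = at-d x y s
  cases P₃ P₁ P₁ _ = at-d x y s
  cases P₃ P₁ P₂ _ = at-b x y s
  cases P₃ P₁ P₃ _ = at-a x y s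
  cases P₃ P₂ P₁ _ = at-b x y s
  cases P₃ P₂ P₂ _ = at-d x y s
  cases P₃ P₂ P₃ _ = at-a x y s

-- First-step equations

record FirstStep (m : ℕ) (s : State (suc m)) : Set where
  field
    three-moves : length (successors s) ≡ 3
    time-mean   : sumOver (expectedTime m) (successors s) ≡ 3 * expectedTime m s - 3
    gather-mean : ∀ c → sumOver (λ u → gatherWeight m u c) (successors s) ≡ 3 * gatherWeight m s c

mean-affine : ∀ a b x₁ x₂ x₃ x → x₁ + (x₂ + (x₃ + 0ℚ)) ≡ 3 * x →
  (a + b * x₁) + ((a + b * x₂) + ((a + b * x₃) + 0ℚ)) ≡ 3 * (a + b * x)
mean-affine a b x₁ x₂ x₃ x mean =
  trans (regroup a b x₁ x₂ x₃) (trans (cong (λ t → 3 * a + b * t) mean) (factor a b x))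
  where
  regroup : ∀ a b x₁ x₂ x₃ →
    (a + b * x₁) + ((a + b * x₂) + ((a + b * x₃) + 0ℚ)) ≡ 3 * a + b * (x₁ + (x₂ + (x₃ + 0ℚ)))
  regroup = solve-∀ ℚ-ring
  factor : ∀ a b x → 3 * a + b * (3 * x) ≡ 3 * (a + b * x)
  factor = solve-∀ ℚ-ring

mean-combination : ∀ b x₁ x₂ x₃ x y₁ y₂ y₃ y →
  x₁ + (x₂ + (x₃ + 0ℚ)) ≡ 3 * x → y₁ + (y₂ + (y₃ + 0ℚ)) ≡ 3 * y →
  (x₁ + b * y₁) + ((x₂ + b * y₂) + ((x₃ + b * y₃) + 0ℚ)) ≡ 3 * (x + b * y)
mean-combination b x₁ x₂ x₃ x y₁ y₂ y₃ y x-mean y-mean =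
  trans (regroup b x₁ x₂ x₃ y₁ y₂ y₃)
    (trans (cong₂ (λ s t → s + b * t) x-mean y-mean) (factor b x y))
  where
  regroup : ∀ b x₁ x₂ x₃ y₁ y₂ y₃ →
    (x₁ + b * y₁) + ((x₂ + b * y₂) + ((x₃ + b * y₃) + 0ℚ))
      ≡ (x₁ + (x₂ + (x₃ + 0ℚ))) + b * (y₁ + (y₂ + (y₃ + 0ℚ)))
  regroup = solve-∀ ℚ-ring
  factor : ∀ b x y → 3 * x + b * (3 * y) ≡ 3 * (x + b * y)
  factor = solve-∀ ℚ-ring

gatherStep-mean : ∀ m d c (w₁ w₂ w₃ w : Peg → ℚ) → (∀ e → w₁ e + (w₂ e + (w₃ e + 0ℚ)) ≡ 3 * w e) →
  gatherStep m w₁ d c + (gatherStep m w₂ d c + (gatherStep m w₃ d c + 0ℚ)) ≡ 3 * gatherStep m w d c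
gatherStep-mean m d c w₁ w₂ w₃ w mean with does (c ≟ᶠ d)
... | true  = mean-affine (2 * 5 ^ suc m) 3 (w₁ d) (w₂ d) (w₃ d) (w d) (mean d)
... | false = mean-combination 2 (w₁ c) (w₂ c) (w₃ c) (w c)
                (w₁ (otherPeg c d)) (w₂ (otherPeg c d)) (w₃ (otherPeg c d)) (w (otherPeg c d))
                (mean c) (mean (otherPeg c d))

time-mean-∷ʳ : ∀ m (xs : State (suc m)) d (us : List (State (suc m))) → length us ≡ 3 →
  sumOver (expectedTime m) us ≡ 3 * expectedTime m xs - 3 →
  sumOver (λ u → gatherWeight m u d) us ≡ 3 * gatherWeight m xs d →
  sumOver (expectedTime (suc m)) (map (_∷ʳ d) us) ≡ 3 * expectedTime (suc m) (xs ∷ʳ d) - 3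
time-mean-∷ʳ m xs d (u₁ ∷ u₂ ∷ u₃ ∷ []) refl time-mean gather-mean
  rewrite expectedTime-∷ʳ m u₁ d | expectedTime-∷ʳ m u₂ d | expectedTime-∷ʳ m u₃ d
        | expectedTime-∷ʳ m xs d
  = trans (regroup (expectedTime m u₁) (expectedTime m u₂) (expectedTime m u₃)
                   (gatherWeight m u₁ d) (gatherWeight m u₂ d) (gatherWeight m u₃ d) (totalWeight m))
      (trans (cong₂ (λ e q → e + k * (3 * totalWeight m - q)) time-mean gather-mean)
        (factor (expectedTime m xs) (gatherWeight m xs d) (totalWeight m)))
  where
  k = + 3 / 2
  regroup : ∀ e₁ e₂ e₃ q₁ q₂ q₃ T →
    (e₁ + k * (T - q₁)) + ((e₂ + k * (T - q₂)) + ((e₃ + k * (T - q₃)) + 0ℚ))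
      ≡ (e₁ + (e₂ + (e₃ + 0ℚ))) + k * (3 * T - (q₁ + (q₂ + (q₃ + 0ℚ))))
  regroup = solve-∀ ℚ-ring
  factor : ∀ e q T → (3 * e - 3) + k * (3 * T - 3 * q) ≡ 3 * (e + k * (T - q)) - 3
  factor = solve-∀ ℚ-ring

gather-mean-∷ʳ : ∀ m (xs : State (suc m)) d (us : List (State (suc m))) → length us ≡ 3 →
  (∀ c → sumOver (λ u → gatherWeight m u c) us ≡ 3 * gatherWeight m xs c) →
  ∀ c → sumOver (λ u → gatherWeight (suc m) u c) (map (_∷ʳ d) us)
          ≡ 3 * gatherWeight (suc m) (xs ∷ʳ d) c
gather-mean-∷ʳ m xs d (u₁ ∷ u₂ ∷ u₃ ∷ []) refl gather-mean c
  rewrite gatherWeight-∷ʳ m u₁ d c | gatherWeight-∷ʳ m u₂ d c | gatherWeight-∷ʳ m u₃ d c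
        | gatherWeight-∷ʳ m xs d c
  = gatherStep-mean m d c (gatherWeight m u₁) (gatherWeight m u₂) (gatherWeight m u₃)
      (gatherWeight m xs) gather-mean

firstStep-∷ʳ : ∀ m (xs : State (suc m)) d → allSame xs ≡ false → FirstStep m xs →
  FirstStep (suc m) (xs ∷ʳ d)
firstStep-∷ʳ m xs d unsolved H = record
  { three-moves = trans (cong length moves) (trans (length-map (_∷ʳ d) (successors xs)) three-moves)
  ; time-mean   = trans (cong (sumOver _) moves)
                    (time-mean-∷ʳ m xs d (successors xs) three-moves time-mean (gather-mean d))
  ; gather-mean = λ c → trans (cong (sumOver _) moves)
                    (gather-mean-∷ʳ m xs d (successors xs) three-moves gather-mean c)
  }
  where
  open FirstStep H
  moves = successors-∷ʳ xs d unsolved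

splitTower-time-mean : ∀ m a d → a ≠ d → let b = otherPeg a d in
  expectedTime (suc m) ((d ∷ replicate m a) ∷ʳ d) + expectedTime (suc m) ((b ∷ replicate m a) ∷ʳ d)
    + expectedTime (suc m) (splitTower m a b) ≡ 3 * expectedTime (suc m) (splitTower m a d) - 3
splitTower-time-mean m a d a≠d = begin
  expectedTime (suc m) ((d ∷ replicate m a) ∷ʳ d) + expectedTime (suc m) ((b ∷ replicate m a) ∷ʳ d)
    + expectedTime (suc m) (splitTower m a b)
    ≡⟨ cong₂ _+_ (cong₂ _+_ (near d a≠d (nearTowerWeight-near m a d d≠a))
                            (near b a≠b (nearTowerWeight-far m a b d d≠a d≠b)))
                 (expectedTime-splitTower m a b a≠b) ⟩
  (k * (3 ^ m - 1) + k * (totalWeight m - (3 ^ m + (- 1) ^ m)))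
    + (k * (3 ^ m - 1) + k * (totalWeight m - (3 ^ m - (- 1) ^ m))) + k * totalWeight m
    ≡⟨ identity (3 ^ m) ((- 1) ^ m) (totalWeight m) ⟩
  3 * (k * totalWeight m) - 3
    ≡⟨ cong (λ t → 3 * t - 3) (expectedTime-splitTower m a d a≠d) ⟨
  3 * expectedTime (suc m) (splitTower m a d) - 3 ∎
  where
  open ≡-Reasoning
  k = + 3 / 2
  b = otherPeg a d
  d≠a = ≠-sym a d a≠d
  a≠b = proj₁ (otherPeg-≠ a d a≠d)
  d≠b = proj₂ (otherPeg-≠ a d a≠d)
  near : ∀ x → a ≠ x → ∀ {w} → nearTowerWeight m a x d ≡ w →
    expectedTime (suc m) ((x ∷ replicate m a) ∷ʳ d) ≡ k * (3 ^ m - 1) + k * (totalWeight m - w)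
  near x a≠x weight = expectedTime-∷ʳ′ m _ d (expectedTime-nearTower m a x a≠x)
    (trans (gatherWeight-nearTower m a x d a≠x) weight)
  identity : ∀ y s T →
    (k * (y - 1) + k * (T - (y + s))) + (k * (y - 1) + k * (T - (y - s))) + k * T ≡ 3 * (k * T) - 3
  identity = solve-∀ ℚ-ring

splitTower-gather-mean : ∀ m a d c → a ≠ d → let b = otherPeg a d in
  gatherWeight (suc m) ((d ∷ replicate m a) ∷ʳ d) c
    + gatherWeight (suc m) ((b ∷ replicate m a) ∷ʳ d) c + gatherWeight (suc m) (splitTower m a b) c
    ≡ 3 * gatherWeight (suc m) (splitTower m a d) c
splitTower-gather-mean m a d c a≠d = begin
  gatherWeight (suc m) ((d ∷ replicate m a) ∷ʳ d) c
    + gatherWeight (suc m) ((b ∷ replicate m a) ∷ʳ d) c + gatherWeight (suc m) (splitTower m a b) c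
    ≡⟨ cong₂ _+_ (cong₂ _+_ (near d a≠d) (near b (proj₁ (otherPeg-≠ a d a≠d))))
                 (gatherWeight-splitTower m a b c) ⟩
  gatherStep m (nearTowerWeight m a d) d c + gatherStep m (nearTowerWeight m a b) d c
    + gatherStep m (towerWeight m a) b c
    ≡⟨ splitTower-gatherStep-mean m a d c a≠d ⟩
  3 * gatherStep m (towerWeight m a) d c
    ≡⟨ cong (3 *_) (gatherWeight-splitTower m a d c) ⟨
  3 * gatherWeight (suc m) (splitTower m a d) c ∎
  where
  open ≡-Reasoning
  b = otherPeg a d
  near : ∀ x → a ≠ x →
    gatherWeight (suc m) ((x ∷ replicate m a) ∷ʳ d) c ≡ gatherStep m (nearTowerWeight m a x) d c
  near x a≠x = gatherWeight-∷ʳ′ m _ d c (λ e → gatherWeight-nearTower m a x e a≠x)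

splitTower-firstStep : ∀ m a d → a ≠ d → FirstStep (suc m) (splitTower m a d)
splitTower-firstStep m a d a≠d = record
  { three-moves = proj₁ moves
  ; time-mean   = trans (sum-moves (expectedTime (suc m))) (splitTower-time-mean m a d a≠d)
  ; gather-mean = λ c → trans (sum-moves (λ u → gatherWeight (suc m) u c))
                               (splitTower-gather-mean m a d c a≠d)
  }
  where
  b = otherPeg a d
  moves = splitTower-moves m a d a≠d
  sum-moves : ∀ f → sumOver f (successors (splitTower m a d)) ≡
    f ((d ∷ replicate m a) ∷ʳ d) + f ((b ∷ replicate m a) ∷ʳ d) + f (splitTower m a b)
  sum-moves f = trans (proj₂ moves f)
    (cong (λ u → f ((d ∷ replicate m a) ∷ʳ d) + f ((b ∷ replicate m a) ∷ʳ d) + f u)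
          (∷ʳ-[fromℕ]≔ (replicate (suc m) a) b d))

tower-∷ʳ-firstStep : ∀ m (xs : State (suc m)) d → allSame xs ≡ true → allSame (xs ∷ʳ d) ≡ false →
  FirstStep (suc m) (xs ∷ʳ d)
tower-∷ʳ-firstStep m (x ∷ ys) d solved unsolved with solved⇒replicate x ys solved
... | refl with x ≟ᶠ d
...   | no x≢d   = splitTower-firstStep m x d (dec-false (x ≟ᶠ d) x≢d)
...   | yes refl with () ← trans (sym unsolved)
    (trans (cong allSame (replicate-∷ʳ (suc m) x)) (allSame-replicate (suc m) x))

firstStep : ∀ m (s : State (suc m)) → allSame s ≡ false → FirstStep m s
firstStep zero    (a ∷ []) ()
firstStep (suc m) s unsolved with initLast s
... | xs , d , refl with allSame xs in allSame-xs
...   | false = firstStep-∷ʳ m xs d allSame-xs (firstStep m xs allSame-xs)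
...   | true  = tower-∷ʳ-firstStep m xs d allSame-xs unsolved

-- The potential of a distribution

solved⇒expectedTime≡0 : ∀ m (s : State (suc m)) → allSame s ≡ true → expectedTime m s ≡ 0
solved⇒expectedTime≡0 m (x ∷ ys) solved with solved⇒replicate x ys solved
... | refl = expectedTime-replicate m x

potential : (n : ℕ) → Dist (suc n) → ℚ
potential n []            = 0ℚ
potential n ((s , w) ∷ d) = w * expectedTime n s + potential n d

potential-++ : ∀ n (l d : Dist (suc n)) → potential n (l ++ d) ≡ potential n l + potential n d
potential-++ n []            d = sym (+-identityˡ (potential n d))
potential-++ n ((s , w) ∷ l) d = trans (cong (_+_ (w * expectedTime n s)) (potential-++ n l d))
  (sym (+-assoc (w * expectedTime n s) (potential n l) (potential n d)))

potential-uniform : ∀ n c (us : List (State (suc n))) →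
  potential n (map (λ u → (u , c)) us) ≡ c * sumOver (expectedTime n) us
potential-uniform n c []       = sym (*-zeroʳ c)
potential-uniform n c (u ∷ us) =
  trans (cong (_+_ (c * expectedTime n u)) (potential-uniform n c us))
    (sym (*-distribˡ-+ c (expectedTime n u) (sumOver (expectedTime n) us)))

potential-successors : ∀ n (s : State (suc n)) w → allSame s ≡ false →
  potential n (map (λ u → (u , w * (+ 1 / 3))) (successors s)) + w ≡ w * expectedTime n s
potential-successors n s w unsolved = begin
  potential n (map (λ u → (u , w * (+ 1 / 3))) (successors s)) + w
    ≡⟨ cong (_+ w) (potential-uniform n (w * (+ 1 / 3)) (successors s)) ⟩
  w * (+ 1 / 3) * sumOver (expectedTime n) (successors s) + w
    ≡⟨ cong (λ e → w * (+ 1 / 3) * e + w) (FirstStep.time-mean (firstStep n s unsolved)) ⟩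
  w * (+ 1 / 3) * (3 * expectedTime n s - 3) + w
    ≡⟨ identity w (expectedTime n s) ⟩
  w * expectedTime n s ∎
  where
  open ≡-Reasoning
  identity : ∀ w e → w * (+ 1 / 3) * (3 * e - 3) + w ≡ w * e
  identity = solve-∀ ℚ-ring

length-successors : ∀ n (s : State (suc n)) → allSame s ≡ false → length (successors s) ≡ 3
length-successors n s unsolved = FirstStep.three-moves (firstStep n s unsolved)

step-potential : ∀ n (d : Dist (suc n)) → potential n (step d) + unsolvedMass d ≡ potential n d
step-potential n [] = refl
step-potential n ((s , w) ∷ d) with allSame s in allSame-s | successors s in moves
... | true  | _ rewrite solved⇒expectedTime≡0 n s allSame-s =
  trans (identity (potential n (step d)) (unsolvedMass d) w)
    (cong (_+_ (w * 0)) (step-potential n d))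
  where
  identity : ∀ P M w → P + (0 + M) ≡ w * 0 + (P + M)
  identity = solve-∀ ℚ-ring
... | false | [] with () ← trans (cong length (sym moves)) (length-successors n s allSame-s)
... | false | t ∷ ts
  rewrite ℕ.suc-injective (trans (cong length (sym moves)) (length-successors n s allSame-s)) = begin
  potential n (spread (t ∷ ts) ++ step d) + (w + unsolvedMass d)
    ≡⟨ cong (_+ (w + unsolvedMass d)) (potential-++ n (spread (t ∷ ts)) (step d)) ⟩
  (potential n (spread (t ∷ ts)) + potential n (step d)) + (w + unsolvedMass d)
    ≡⟨ regroup (potential n (spread (t ∷ ts))) (potential n (step d)) w (unsolvedMass d) ⟩
  (potential n (spread (t ∷ ts)) + w) + (potential n (step d) + unsolvedMass d)
    ≡⟨ cong₂ _+_ (trans (cong (λ l → potential n (spread l) + w) (sym moves))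
                        (potential-successors n s w allSame-s))
                 (step-potential n d) ⟩
  w * expectedTime n s + potential n d ∎
  where
  open ≡-Reasoning
  spread : List (State _) → Dist _
  spread = map (λ u → (u , w * (+ 1 / 3)))
  regroup : ∀ S P w M → (S + P) + (w + M) ≡ (S + w) + (P + M)
  regroup = solve-∀ ℚ-ring

partialExp-potential : ∀ n t →
  partialExp n t + potential n (distAt n t) ≡ expectedTime n (startState n)
partialExp-potential n zero    = identity (expectedTime n (startState n))
  where
  identity : ∀ e → 0ℚ + (1ℚ * e + 0ℚ) ≡ e
  identity = solve-∀ ℚ-ring
partialExp-potential n (suc t) = trans
  (regroup (partialExp n t) (probGreater n t) (potential n (step (distAt n t))))
  (trans (cong (_+_ (partialExp n t)) (step-potential n (distAt n t))) (partialExp-potential n t))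
  where
  regroup : ∀ P M S → (P + M) + S ≡ P + (S + M)
  regroup = solve-∀ ℚ-ring

0≤y-x⇒x≤y : ∀ {x y} → 0ℚ ≤ y - x → x ≤ y
0≤y-x⇒x≤y {x} {y} 0≤y-x = subst₂ _≤_ (+-identityˡ x) (identity x y) (+-monoˡ-≤ x 0≤y-x)
  where
  identity : ∀ x y → (y - x) + x ≡ y
  identity = solve-∀ ℚ-ring

x≤y⇒0≤y-x : ∀ {x y} → x ≤ y → 0ℚ ≤ y - x
x≤y⇒0≤y-x {x} {y} x≤y = subst (_≤ y - x) (identity x) (+-monoˡ-≤ (- x) x≤y)
  where
  identity : ∀ x → x - x ≡ 0ℚ
  identity = solve-∀ ℚ-ring

0≤+ : ∀ {x y} → 0ℚ ≤ x → 0ℚ ≤ y → 0ℚ ≤ x + y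
0≤+ = +-mono-≤

0≤* : ∀ {x y} → 0ℚ ≤ x → 0ℚ ≤ y → 0ℚ ≤ x * y
0≤* {x} {y} 0≤x 0≤y = subst (_≤ x * y) (*-zeroˡ y) (*-monoʳ-≤-nonNeg y {{nonNegative 0≤y}} 0≤x)

0≤^ : ∀ {x} n → 0ℚ ≤ x → 0ℚ ≤ x ^ n
0≤^ zero    0≤x = nonNegative⁻¹ 1ℚ
0≤^ (suc n) 0≤x = 0≤* 0≤x (0≤^ n 0≤x)

0≤2 : 0ℚ ≤ 2
0≤2 = nonNegative⁻¹ 2

0≤3 : 0ℚ ≤ 3
0≤3 = nonNegative⁻¹ 3

0≤5 : 0ℚ ≤ 5
0≤5 = nonNegative⁻¹ 5

0≤3/2 : 0ℚ ≤ + 3 / 2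
0≤3/2 = nonNegative⁻¹ (+ 3 / 2)

gatherWeight-nonNeg : ∀ m s c → 0ℚ ≤ gatherWeight m s c
gatherWeight-nonNeg zero (a ∷ []) c with does (a ≟ᶠ c)
... | true  = 0≤2
... | false = ≤-refl
gatherWeight-nonNeg (suc m) s c with does (c ≟ᶠ last s)
... | true  = 0≤+ (0≤* 0≤2 (0≤^ (suc m) 0≤5)) (0≤* 0≤3 (gatherWeight-nonNeg m (init s) (last s)))
... | false = 0≤+ (gatherWeight-nonNeg m (init s) c)
                  (0≤* 0≤2 (gatherWeight-nonNeg m (init s) (otherPeg c (last s))))

gatherStep-total : ∀ m w d → w P₁ + w P₂ + w P₃ ≡ totalWeight m →
  gatherStep m w d P₁ + gatherStep m w d P₂ + gatherStep m w d P₃ ≡ totalWeight (suc m)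
gatherStep-total m w d total =
  trans (regroup d) (trans (cong (λ t → A + 3 * t) total) (totalWeight-suc m))
  where
  A = 2 * 5 ^ suc m
  regroup : ∀ d → gatherStep m w d P₁ + gatherStep m w d P₂ + gatherStep m w d P₃
                    ≡ A + 3 * (w P₁ + w P₂ + w P₃)
  regroup P₁ = identity A (w P₁) (w P₂) (w P₃)
    where
    identity : ∀ A x y z → (A + 3 * x) + (y + 2 * z) + (z + 2 * y) ≡ A + 3 * (x + y + z)
    identity = solve-∀ ℚ-ring
  regroup P₂ = identity A (w P₁) (w P₂) (w P₃)
    where
    identity : ∀ A x y z → (x + 2 * z) + (A + 3 * y) + (z + 2 * x) ≡ A + 3 * (x + y + z)
    identity = solve-∀ ℚ-ring
  regroup P₃ = identity A (w P₁) (w P₂) (w P₃)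
    where
    identity : ∀ A x y z → (x + 2 * y) + (y + 2 * x) + (A + 3 * z) ≡ A + 3 * (x + y + z)
    identity = solve-∀ ℚ-ring

gatherWeight-total : ∀ m s →
  gatherWeight m s P₁ + gatherWeight m s P₂ + gatherWeight m s P₃ ≡ totalWeight m
gatherWeight-total zero    (P₁ ∷ []) = refl
gatherWeight-total zero    (P₂ ∷ []) = refl
gatherWeight-total zero    (P₃ ∷ []) = refl
gatherWeight-total (suc m) s =
  gatherStep-total m (gatherWeight m (init s)) (last s) (gatherWeight-total m (init s))

gatherWeight-≤ : ∀ m s c → gatherWeight m s c ≤ totalWeight m
gatherWeight-≤ m s c = subst (gatherWeight m s c ≤_) (gatherWeight-total m s) (below c)
  where
  q = gatherWeight m s
  below : ∀ c → q c ≤ q P₁ + q P₂ + q P₃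
  below P₁ = 0≤y-x⇒x≤y (subst (0ℚ ≤_) (identity (q P₁) (q P₂) (q P₃))
                          (0≤+ (gatherWeight-nonNeg m s P₂) (gatherWeight-nonNeg m s P₃)))
    where
    identity : ∀ x y z → y + z ≡ (x + y + z) - x
    identity = solve-∀ ℚ-ring
  below P₂ = 0≤y-x⇒x≤y (subst (0ℚ ≤_) (identity (q P₁) (q P₂) (q P₃))
                          (0≤+ (gatherWeight-nonNeg m s P₁) (gatherWeight-nonNeg m s P₃)))
    where
    identity : ∀ x y z → x + z ≡ (x + y + z) - y
    identity = solve-∀ ℚ-ring
  below P₃ = 0≤y-x⇒x≤y (subst (0ℚ ≤_) (identity (q P₁) (q P₂) (q P₃))
                          (0≤+ (gatherWeight-nonNeg m s P₁) (gatherWeight-nonNeg m s P₂)))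
    where
    identity : ∀ x y z → x + y ≡ (x + y + z) - z
    identity = solve-∀ ℚ-ring

expectedTime-nonNeg : ∀ m s → 0ℚ ≤ expectedTime m s
expectedTime-nonNeg zero    s = ≤-refl
expectedTime-nonNeg (suc m) s = 0≤+ (expectedTime-nonNeg m (init s))
  (0≤* 0≤3/2 (x≤y⇒0≤y-x (gatherWeight-≤ m (init s) (last s))))

expectedTime-≤ : ∀ m s → expectedTime m s ≤ 5 ^ suc m
expectedTime-≤ zero    s = 0≤5
expectedTime-≤ (suc m) s = 0≤y-x⇒x≤y (subst (0ℚ ≤_) (identity (5 ^ suc m) (3 ^ suc m) e q)
  (0≤+ (0≤+ (0≤+ (x≤y⇒0≤y-x (expectedTime-≤ m (init s)))
                 (0≤* 0≤3/2 (gatherWeight-nonNeg m (init s) (last s))))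
            (0≤* 0≤3/2 (0≤^ (suc m) 0≤3)))
       (0≤* (nonNegative⁻¹ (+ 5 / 2)) (0≤^ (suc m) 0≤5))))
  where
  e = expectedTime m (init s)
  q = gatherWeight m (init s) (last s)
  identity : ∀ X Y e q → (X - e) + (+ 3 / 2) * q + (+ 3 / 2) * Y + (+ 5 / 2) * X
                           ≡ 5 * X - (e + (+ 3 / 2) * ((X - Y) - q))
  identity = solve-∀ ℚ-ring

NonNegWeights : ∀ {n} → Dist n → Set
NonNegWeights = All (λ sw → 0ℚ ≤ proj₂ sw)

step-nonNeg : ∀ {n} (d : Dist n) → NonNegWeights d → NonNegWeights (step d)
step-nonNeg []            []          = []
step-nonNeg ((s , w) ∷ d) (0≤w ∷ 0≤d) with allSame s | successors s
... | true  | _      = step-nonNeg d 0≤d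
... | false | []     = step-nonNeg d 0≤d
... | false | t ∷ ts = ++⁺ (map⁺ (All.universal (λ _ → 0≤* 0≤w 0≤1/k) (t ∷ ts))) (step-nonNeg d 0≤d)
  where
  0≤1/k = nonNegative⁻¹ (+ 1 / suc (length ts)) {{normalize-nonNeg 1 (suc (length ts))}}

distAt-nonNeg : ∀ n t → NonNegWeights (distAt n t)
distAt-nonNeg n zero    = nonNegative⁻¹ 1ℚ ∷ []
distAt-nonNeg n (suc t) = step-nonNeg (distAt n t) (distAt-nonNeg n t)

unsolvedMass-nonNeg : ∀ {n} (d : Dist n) → NonNegWeights d → 0ℚ ≤ unsolvedMass d
unsolvedMass-nonNeg []            []          = ≤-refl
unsolvedMass-nonNeg ((s , w) ∷ d) (0≤w ∷ 0≤d) with allSame s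
... | true  = 0≤+ ≤-refl (unsolvedMass-nonNeg d 0≤d)
... | false = 0≤+ 0≤w (unsolvedMass-nonNeg d 0≤d)

potential-nonNeg : ∀ n (d : Dist (suc n)) → NonNegWeights d → 0ℚ ≤ potential n d
potential-nonNeg n []            []          = ≤-refl
potential-nonNeg n ((s , w) ∷ d) (0≤w ∷ 0≤d) =
  0≤+ (0≤* 0≤w (expectedTime-nonNeg n s)) (potential-nonNeg n d 0≤d)

potential-≤ : ∀ n K → (∀ s → expectedTime n s ≤ K) →
  ∀ (d : Dist (suc n)) → NonNegWeights d → potential n d ≤ K * unsolvedMass d
potential-≤ n K time≤K []            []          = ≤-reflexive (sym (*-zeroʳ K))
potential-≤ n K time≤K ((s , w) ∷ d) (0≤w ∷ 0≤d) with allSame s in solved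
... | true rewrite solved⇒expectedTime≡0 n s solved =
  subst₂ _≤_ (identityˡ w (potential n d)) (identityʳ K (unsolvedMass d))
    (potential-≤ n K time≤K d 0≤d)
  where
  identityˡ : ∀ w P → P ≡ w * 0 + P
  identityˡ = solve-∀ ℚ-ring
  identityʳ : ∀ K M → K * M ≡ K * (0 + M)
  identityʳ = solve-∀ ℚ-ring
... | false = subst (w * expectedTime n s + potential n d ≤_) (identity K w (unsolvedMass d))
  (+-mono-≤ (*-monoˡ-≤-nonNeg w {{nonNegative 0≤w}} (time≤K s)) (potential-≤ n K time≤K d 0≤d))
  where
  identity : ∀ K w M → w * K + K * M ≡ K * (w + M)
  identity = solve-∀ ℚ-ring

coprime-1 : ∀ k → Coprime.Coprime k 1
coprime-1 k = Coprime.sym (Coprime.1-coprimeTo k)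

fromℕℚ≡mkℚ : ∀ k → fromℕℚ k ≡ mkℚ (+ k) 0 (coprime-1 k)
fromℕℚ≡mkℚ k = normalize-coprime (coprime-1 k)

fromℕℚ-+ : ∀ a b → fromℕℚ (a ℕ.+ b) ≡ fromℕℚ a + fromℕℚ b
fromℕℚ-+ a b rewrite fromℕℚ≡mkℚ (a ℕ.+ b) | fromℕℚ≡mkℚ a | fromℕℚ≡mkℚ b =
  toℚᵘ-injective (ℚᵘ.≃-trans (ℚᵘ.*≡* (cong (ℤ._* + 1) numerators))
    (ℚᵘ.≃-sym (toℚᵘ-homo-+ (mkℚ (+ a) 0 (coprime-1 a)) (mkℚ (+ b) 0 (coprime-1 b)))))
  where
  numerators : + (a ℕ.+ b) ≡ + a ℤ.* + 1 ℤ.+ + b ℤ.* + 1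
  numerators = trans (ℤ.pos-+ a b) (sym (cong₂ ℤ._+_ (ℤ.*-identityʳ (+ a)) (ℤ.*-identityʳ (+ b))))

fromℕℚ-* : ∀ a b → fromℕℚ (a ℕ.* b) ≡ fromℕℚ a * fromℕℚ b
fromℕℚ-* a b rewrite fromℕℚ≡mkℚ (a ℕ.* b) | fromℕℚ≡mkℚ a | fromℕℚ≡mkℚ b =
  toℚᵘ-injective (ℚᵘ.≃-trans (ℚᵘ.*≡* (cong (ℤ._* + 1) (ℤ.pos-* a b)))
    (ℚᵘ.≃-sym (toℚᵘ-homo-* (mkℚ (+ a) 0 (coprime-1 a)) (mkℚ (+ b) 0 (coprime-1 b)))))

fromℕℚ-^ : ∀ k n → fromℕℚ (k ℕ.^ n) ≡ fromℕℚ k ^ n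
fromℕℚ-^ k zero    = refl
fromℕℚ-^ k (suc n) = trans (fromℕℚ-* k (k ℕ.^ n)) (cong (fromℕℚ k *_) (fromℕℚ-^ k n))

0≤fromℕℚ : ∀ k → 0ℚ ≤ fromℕℚ k
0≤fromℕℚ k = nonNegative⁻¹ (fromℕℚ k) {{normalize-nonNeg k 1}}

fromℕℚ-mono-≤ : ∀ {a b} → a ℕ.≤ b → fromℕℚ a ≤ fromℕℚ b
fromℕℚ-mono-≤ {a} {b} a≤b = subst (fromℕℚ a ≤_)
  (trans (sym (fromℕℚ-+ a (b ℕ.∸ a))) (cong fromℕℚ (ℕ.m+[n∸m]≡n a≤b)))
  (subst (_≤ fromℕℚ a + fromℕℚ (b ℕ.∸ a)) (+-identityʳ (fromℕℚ a))
    (+-monoʳ-≤ (fromℕℚ a) (0≤fromℕℚ (b ℕ.∸ a))))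

fromℕℚ<fromℕℚ-suc : ∀ c → fromℕℚ c < fromℕℚ (suc c)
fromℕℚ<fromℕℚ-suc c = subst₂ _<_ (+-identityˡ (fromℕℚ c)) (sym (fromℕℚ-+ 1 c))
  (+-monoˡ-< (fromℕℚ c) (positive⁻¹ 1ℚ))

mkℚ*denominator : ∀ p b .(c : Coprime.Coprime (suc p) (suc b)) →
  mkℚ ℤ.+[1+ p ] b c * fromℕℚ (suc b) ≡ fromℕℚ (suc p)
mkℚ*denominator p b c rewrite fromℕℚ≡mkℚ (suc b) | fromℕℚ≡mkℚ (suc p) =
  toℚᵘ-injective (ℚᵘ.≃-trans
    (toℚᵘ-homo-* (mkℚ ℤ.+[1+ p ] b c) (mkℚ (+ suc b) 0 (coprime-1 (suc b)))) (ℚᵘ.*≡* cross))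
  where
  cross : (ℤ.+[1+ p ] ℤ.* + suc b) ℤ.* + 1 ≡ ℤ.+[1+ p ] ℤ.* + (suc b ℕ.* 1)
  cross = trans (ℤ.*-identityʳ _) (cong (λ z → ℤ.+[1+ p ] ℤ.* + z) (sym (ℕ.*-identityʳ (suc b))))

eventually-small : ∀ (c : ℕ) (ε : ℚ) → 0ℚ < ε →
  ∃ λ N → ∀ t → t ≥ N → ∀ a → fromℕℚ t * a ≤ fromℕℚ c → a < ε
eventually-small c (mkℚ (+ 0)       _ _) 0<ε with () ← positive 0<ε
eventually-small c (mkℚ ℤ.-[1+ _ ] _ _) 0<ε with () ← positive 0<ε
eventually-small c ε@(mkℚ ℤ.+[1+ p ] b coprime) _ = suc c ℕ.* suc b , small
  where
  0≤ε = nonNegative⁻¹ ε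
  N = suc c ℕ.* suc b
  Nε≡ : fromℕℚ N * ε ≡ fromℕℚ (suc c ℕ.* suc p)
  Nε≡ = begin
    fromℕℚ N * ε                          ≡⟨ cong (_* ε) (fromℕℚ-* (suc c) (suc b)) ⟩
    fromℕℚ (suc c) * fromℕℚ (suc b) * ε   ≡⟨ *-assoc (fromℕℚ (suc c)) (fromℕℚ (suc b)) ε ⟩
    fromℕℚ (suc c) * (fromℕℚ (suc b) * ε) ≡⟨ cong (fromℕℚ (suc c) *_) (*-comm (fromℕℚ (suc b)) ε) ⟩
    fromℕℚ (suc c) * (ε * fromℕℚ (suc b)) ≡⟨ cong (fromℕℚ (suc c) *_) (mkℚ*denominator p b coprime) ⟩
    fromℕℚ (suc c) * fromℕℚ (suc p)       ≡⟨ fromℕℚ-* (suc c) (suc p) ⟨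
    fromℕℚ (suc c ℕ.* suc p)              ∎
    where open ≡-Reasoning
  small : ∀ t → t ≥ N → ∀ a → fromℕℚ t * a ≤ fromℕℚ c → a < ε
  small t t≥N a ta≤c with a <? ε
  ... | yes a<ε = a<ε
  ... | no  a≮ε = ⊥-elim (<-irrefl refl (<-≤-trans c<ta ta≤c))
    where
    c<ta : fromℕℚ c < fromℕℚ t * a
    c<ta = begin-strict
      fromℕℚ c                 <⟨ fromℕℚ<fromℕℚ-suc c ⟩
      fromℕℚ (suc c)           ≤⟨ fromℕℚ-mono-≤ (ℕ.m≤m*n (suc c) (suc p)) ⟩
      fromℕℚ (suc c ℕ.* suc p) ≡⟨ Nε≡ ⟨
      fromℕℚ N * ε             ≤⟨ *-monoʳ-≤-nonNeg ε {{nonNegative 0≤ε}} (fromℕℚ-mono-≤ t≥N) ⟩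
      fromℕℚ t * ε             ≤⟨ *-monoˡ-≤-nonNeg (fromℕℚ t) {{nonNegative (0≤fromℕℚ t)}}
                                                    (≮⇒≥ a≮ε) ⟩
      fromℕℚ t * a             ∎
      where open ≤-Reasoning

-- Since the potential is at most K times the unsolved mass that it loses in each
-- step, it decays like K / (K + t).
potential-decay : ∀ n K → (∀ s → expectedTime n s ≤ K) → ∀ t →
  (K + fromℕℚ t) * potential n (distAt n t) ≤ K * potential n (distAt n 0)
potential-decay n K time≤K zero    =
  ≤-reflexive (cong (_* potential n (distAt n 0)) (+-identityʳ K))
potential-decay n K time≤K (suc t) = ≤-trans one-step (potential-decay n K time≤K t)
  where
  T = fromℕℚ t
  Φ = potential n (distAt n (suc t))
  M = unsolvedMass (distAt n t)
  conserved : Φ + M ≡ potential n (distAt n t)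
  conserved = step-potential n (distAt n t)
  Φ+M≤KM : Φ + M ≤ K * M
  Φ+M≤KM = subst (_≤ K * M) (sym conserved)
    (potential-≤ n K time≤K (distAt n t) (distAt-nonNeg n t))
  identity : ∀ K T Φ M → (K + T) * (Φ + M) - (K + (1ℚ + T)) * Φ ≡ (K * M - (Φ + M)) + (1ℚ + T) * M
  identity = solve-∀ ℚ-ring
  one-step : (K + fromℕℚ (suc t)) * Φ ≤ (K + T) * potential n (distAt n t)
  one-step = subst₂ (λ x y → (K + x) * Φ ≤ (K + T) * y) (sym (fromℕℚ-+ 1 t)) conserved
    (0≤y-x⇒x≤y (subst (0ℚ ≤_) (sym (identity K T Φ M))
      (0≤+ (x≤y⇒0≤y-x Φ+M≤KM)
           (0≤* (0≤+ (nonNegative⁻¹ 1ℚ) (0≤fromℕℚ t))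
                (unsolvedMass-nonNeg (distAt n t) (distAt-nonNeg n t))))))

timeBound : ℕ → ℕ
timeBound n = 5 ℕ.^ suc n

expectedTime-≤-timeBound : ∀ n s → expectedTime n s ≤ fromℕℚ (timeBound n)
expectedTime-≤-timeBound n s =
  subst (expectedTime n s ≤_) (sym (fromℕℚ-^ 5 (suc n))) (expectedTime-≤ n s)

potential-scaled-≤ : ∀ n t →
  fromℕℚ t * potential n (distAt n t) ≤ fromℕℚ (timeBound n ℕ.* timeBound n)
potential-scaled-≤ n t = begin
  fromℕℚ t * Φ       ≤⟨ 0≤y-x⇒x≤y (subst (0ℚ ≤_) (sym (identity K (fromℕℚ t) Φ))
                           (0≤* (0≤fromℕℚ (timeBound n))
                                (potential-nonNeg n (distAt n t) (distAt-nonNeg n t)))) ⟩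
  (K + fromℕℚ t) * Φ ≤⟨ potential-decay n K (expectedTime-≤-timeBound n) t ⟩
  K * potential n (distAt n 0)
                     ≤⟨ *-monoˡ-≤-nonNeg K {{nonNegative (0≤fromℕℚ (timeBound n))}}
                          (subst (_≤ K) (sym (initial (expectedTime n (startState n))))
                            (expectedTime-≤-timeBound n (startState n))) ⟩
  K * K              ≡⟨ fromℕℚ-* (timeBound n) (timeBound n) ⟨
  fromℕℚ (timeBound n ℕ.* timeBound n) ∎
  where
  open ≤-Reasoning
  K = fromℕℚ (timeBound n)
  Φ = potential n (distAt n t)
  identity : ∀ K t Φ → (K + t) * Φ - t * Φ ≡ K * Φ
  identity = solve-∀ ℚ-ring
  initial : ∀ e → 1ℚ * e + 0ℚ ≡ e
  initial = solve-∀ ℚ-ring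

startState≡replicate : ∀ n → startState n ≡ replicate n P₁ ∷ʳ P₂
startState≡replicate zero    = refl
startState≡replicate (suc n) = cong (P₁ ∷_) (startState≡replicate n)

expectedTime-startState : ∀ n → expectedTime n (startState n) ≡ formula n
expectedTime-startState zero    = refl
expectedTime-startState (suc m) = begin
  expectedTime (suc m) (startState (suc m))
    ≡⟨ cong (expectedTime (suc m)) (startState≡replicate (suc m)) ⟩
  expectedTime (suc m) (splitTower m P₁ P₂)
    ≡⟨ expectedTime-splitTower m P₁ P₂ refl ⟩
  (+ 3 / 2) * (5 ^ suc m - 3 ^ suc m)
    ≡⟨ cong₂ (λ x y → (+ 3 / 2) * (x - y)) (fromℕℚ-^ 5 (suc m)) (fromℕℚ-^ 3 (suc m)) ⟨
  formula (suc m) ∎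
  where open ≡-Reasoning

distance≡potential : ∀ n t → ∣ partialExp n t - formula n ∣ ≡ potential n (distAt n t)
distance≡potential n t = begin
  ∣ partialExp n t - formula n ∣
    ≡⟨ cong (λ f → ∣ partialExp n t - f ∣)
            (trans (sym (expectedTime-startState n)) (sym (partialExp-potential n t))) ⟩
  ∣ partialExp n t - (partialExp n t + potential n (distAt n t)) ∣
    ≡⟨ cong ∣_∣ (identity (partialExp n t) (potential n (distAt n t))) ⟩
  ∣ - potential n (distAt n t) ∣
    ≡⟨ ∣-p∣≡∣p∣ (potential n (distAt n t)) ⟩
  ∣ potential n (distAt n t) ∣
    ≡⟨ 0≤p⇒∣p∣≡p (potential-nonNeg n (distAt n t) (distAt-nonNeg n t)) ⟩
  potential n (distAt n t) ∎
  where
  open ≡-Reasoning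
  identity : ∀ P Φ → P - (P + Φ) ≡ - Φ
  identity = solve-∀ ℚ-ring

mainTheorem4 : (n : ℕ) → (ε : ℚ) → 0ℚ < ε →
    ∃ λ N → (t : ℕ) → t ≥ N → ∣ partialExp n t - formula n ∣ < ε
mainTheorem4 n ε 0<ε with eventually-small (timeBound n ℕ.* timeBound n) ε 0<ε
... | N , small = N , λ t t≥N → subst (_< ε) (sym (distance≡potential n t))
                                  (small t t≥N (potential n (distAt n t)) (potential-scaled-≤ n t))
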